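{- Every finite compatibly dismantlable lattice $L$ is overlapping: for every cover relation $x\lessdot y$ in $L$, the set $M_L(x)\cap J_L(y)$ contains exactly one element.
   Context: All lattices are finite. For a lattice $L$, $\mathcal{J}_L$ (resp. $\mathcal{M}_L$) is the set of join-irreducible (resp. meet-irreducible) elements; for $j\in\mathcal{J}_L$, $j_*$ is the unique element covered by $j$, and for $m\in\mathcal{M}_L$, $m^*$ is the unique element covering $m$. Let $\mathcal{M}_L(j)=\max\{z\in L: j_*=j\wedge z\}$ and $\mathcal{J}_L(m)=\min\{z\in L: m^*=m\vee z\}$. A pairing on $L$ is a bijection $\kappa:\mathcal{J}_L\to\mathcal{M}_L$ with $\kappa(j)\in\mathcal{M}_L(j)$ for all $j$ and $\kappa^{ -1}(m)\in\mathcal{J}_L(m)$ for all $m$; $L$ is uniquely paired if it has exactly one pairing, denoted $\kappa_L$. A prime pair is a pair $(j_0,m_0)$ with $L=[\hat0,m_0]\sqcup[j_0,\hat1]$. A uniquely paired lattice $L$ is compatibly dismantlable if $|L|=1$ or there is a prime pair $(j_0,m_0)$ such that: (i) $[j_0,\hat1]$ is compatibly dismantlable and $\alpha(j)=j_0\vee j$ defines a bijection $\{j\in\mathcal{J}_L: j_0\le\kappa_L(j)\}\to\mathcal{J}_{[j_0,\hat1]}$ with $\kappa_{[j_0,\hat1]}(\alpha(j))=\kappa_L(j)$; (ii) $[\hat0,m_0]$ is compatibly dismantlable and $\beta(m)=m_0\wedge m$ defines a bijection $\{m\in\mathcal{M}_L:\kappa_L^{ -1}(m)\le m_0\}\to\mathcal{M}_{[\hat0,m_0]}$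 with $\kappa_{[\hat0,m_0]}^{ -1}(\beta(m))=\kappa_L^{ -1}(m)$. For $x\in L$, $J_L(x)=\{j\in\mathcal{J}_L:j\le x\}$ and $M_L(x)=\{j\in\mathcal{J}_L:\kappa_L(j)\ge x\}$. -}

module Defs where

open import Level using (0ℓ)
open import Data.Product using (Σ; _×_; _,_; ∃)
open import Data.Sum using (_⊎_)
open import Data.List using (List)
open import Data.List.Membership.Propositional using (_∈_)
open import Relation.Nullary using (¬_)
open import Relation.Binary.PropositionalEquality using (_≡_)
open import Relation.Binary.Lattice.Structures using (IsBoundedLattice)

record FiniteLattice : Set₁ where
  field
    Carrier  : Set
    _≤_      : Carrier → Carrier → Set
    _∨_      : Carrier → Carrier → Carrier
    _∧_      : Carrier → Carrier → Carrier
    ⊤        : Carrier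
    ⊥        : Carrier
    isBoundedLattice : IsBoundedLattice _≡_ _≤_ _∨_ _∧_ ⊤ ⊥
    elements : List Carrier
    complete : (x : Carrier) → x ∈ elements

  infix 4 _≤_
  infixr 6 _∨_
  infixr 7 _∧_

ExactlyOne : {A : Set} → (A → Set) → Set
ExactlyOne {A} P = Σ A (λ x → P x × ((y : A) → P y → y ≡ x))

module _ (L : FiniteLattice) where
  open FiniteLattice L

  _<_ : Carrier → Carrier → Set
  x < y = x ≤ y × ¬ (x ≡ y)

  _⋖_ : Carrier → Carrier → Set
  x ⋖ y = x < y × ((z : Carrier) → x < z → ¬ (z < y))

  -- Every interval [a,b] of L is itself a lattice (with the induced order,
  -- meet and join). All notions below are relative to an interval [a,b].
  InI : Carrier → Carrier → Carrier → Set
  InI a b z = a ≤ z × z ≤ b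

  LowerCov : Carrier → Carrier → Carrier → Set
  LowerCov a j x = a ≤ x × x ⋖ j

  UpperCov : Carrier → Carrier → Carrier → Set
  UpperCov b m y = y ≤ b × m ⋖ y

  IsJI : Carrier → Carrier → Carrier → Set
  IsJI a b j = InI a b j × ExactlyOne (LowerCov a j)

  IsMI : Carrier → Carrier → Carrier → Set
  IsMI a b m = InI a b m × ExactlyOne (UpperCov b m)

  -- m ∈ M_[a,b](j) = max { z ∈ [a,b] : j_* = j ∧ z }   (j join-irreducible)
  InMset : Carrier → Carrier → Carrier → Carrier → Set
  InMset a b j m =
    (InI a b m × LowerCov a j (j ∧ m)) ×
    ((z : Carrier) → InI a b z → LowerCov a j (j ∧ z) → m ≤ z → z ≡ m)

  -- j ∈ J_[a,b](m) = min { z ∈ [a,b] : m^* = m ∨ z }   (m meet-irreducible)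
  InJset : Carrier → Carrier → Carrier → Carrier → Set
  InJset a b m j =
    (InI a b j × UpperCov b m (m ∨ j)) ×
    ((z : Carrier) → InI a b z → UpperCov b m (m ∨ z) → z ≤ j → z ≡ j)

  -- κ (a function on L; only its values on the join-irreducibles of [a,b]
  -- matter) is a pairing of the lattice [a,b]: it restricts to a bijection
  -- from J_[a,b] to M_[a,b] with κ(j) ∈ M(j) and κ⁻¹(m) ∈ J(m).
  IsPairing : Carrier → Carrier → (Carrier → Carrier) → Set
  IsPairing a b κ =
    ((j : Carrier) → IsJI a b j → IsMI a b (κ j)) ×
    ((j j' : Carrier) → IsJI a b j → IsJI a b j' → κ j ≡ κ j' → j ≡ j') ×
    ((m : Carrier) → IsMI a b m → Σ Carrier (λ j → IsJI a b j × κ j ≡ m)) ×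
    ((j : Carrier) → IsJI a b j → InMset a b j (κ j)) ×
    ((j : Carrier) → IsJI a b j → InJset a b (κ j) j)

  UniquelyPairedBy : Carrier → Carrier → (Carrier → Carrier) → Set
  UniquelyPairedBy a b κ =
    IsPairing a b κ ×
    ((κ' : Carrier → Carrier) → IsPairing a b κ' →
       (j : Carrier) → IsJI a b j → κ' j ≡ κ j)

  IsPrimePair : Carrier → Carrier → Carrier → Carrier → Set
  IsPrimePair a b j₀ m₀ =
    InI a b j₀ × InI a b m₀ ×
    ((z : Carrier) → InI a b z → (z ≤ m₀ ⊎ j₀ ≤ z) × ¬ (z ≤ m₀ × j₀ ≤ z))

  CondUpper : Carrier → Carrier → (Carrier → Carrier) →
              Carrier → (Carrier → Carrier) → Set
  CondUpper a b κ j₀ κ₁ =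
    ((j : Carrier) → IsJI a b j → j₀ ≤ κ j → IsJI j₀ b (j₀ ∨ j)) ×
    ((j j' : Carrier) → IsJI a b j → j₀ ≤ κ j → IsJI a b j' → j₀ ≤ κ j' →
       j₀ ∨ j ≡ j₀ ∨ j' → j ≡ j') ×
    ((j' : Carrier) → IsJI j₀ b j' →
       Σ Carrier (λ j → IsJI a b j × j₀ ≤ κ j × j₀ ∨ j ≡ j')) ×
    ((j : Carrier) → IsJI a b j → j₀ ≤ κ j → κ₁ (j₀ ∨ j) ≡ κ j)

  -- Meet-irreducibles of [a,b] are written as κ(j) for j ∈ J_[a,b]
  -- (κ being a bijection J_[a,b] → M_[a,b]).
  CondLower : Carrier → Carrier → (Carrier → Carrier) →
              Carrier → (Carrier → Carrier) → Set
  CondLower a b κ m₀ κ₂ =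
    ((j : Carrier) → IsJI a b j → j ≤ m₀ → IsMI a m₀ (m₀ ∧ κ j)) ×
    ((j j' : Carrier) → IsJI a b j → j ≤ m₀ → IsJI a b j' → j' ≤ m₀ →
       m₀ ∧ κ j ≡ m₀ ∧ κ j' → κ j ≡ κ j') ×
    ((m' : Carrier) → IsMI a m₀ m' →
       Σ Carrier (λ j → IsJI a b j × j ≤ m₀ × m₀ ∧ κ j ≡ m')) ×
    ((j : Carrier) → IsJI a b j → j ≤ m₀ → IsJI a m₀ j × κ₂ j ≡ m₀ ∧ κ j)

  data CompatDism : Carrier → Carrier → (Carrier → Carrier) → Set where
    single : (a b : Carrier) (κ : Carrier → Carrier) →
             UniquelyPairedBy a b κ → a ≡ b → CompatDism a b κ
    step   : (a b : Carrier) (κ : Carrier → Carrier)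
             (j₀ m₀ : Carrier) (κ₁ κ₂ : Carrier → Carrier) →
             UniquelyPairedBy a b κ →
             IsPrimePair a b j₀ m₀ →
             CompatDism j₀ b κ₁ → CondUpper a b κ j₀ κ₁ →
             CompatDism a m₀ κ₂ → CondLower a b κ m₀ κ₂ →
             CompatDism a b κ

  CompatiblyDismantlable : (Carrier → Carrier) → Set
  CompatiblyDismantlable κ = CompatDism ⊥ ⊤ κ

  InJL : Carrier → Carrier → Set
  InJL x j = IsJI ⊥ ⊤ j × j ≤ x

  InML : (Carrier → Carrier) → Carrier → Carrier → Set
  InML κ x j = IsJI ⊥ ⊤ j × x ≤ κ j

  Overlapping : (Carrier → Carrier) → Set
  Overlapping κ = (x y : Carrier) → x ⋖ y →
                  ExactlyOne (λ j → InML κ x j × InJL y j)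

-- Induct along the dismantling. Given a cover x ⋖ y in [a,b] with prime pair (j₀,m₀), either both
-- x and y lie in [j₀,b], or both lie in [a,m₀], and the compatibility conditions transport the unique
-- element of M(x) ∩ J(y) from that half; or x ≤ m₀ and j₀ ≤ y, and then the element is j₀ itself.
-- Indeed j₀ is paired with m₀, whose only upper cover is m₀ ∨ j₀; any other candidate j satisfies
-- j₀ ≤ j and j₀ ≰ κ j because x ⋖ y, which by minimality of j in J(κ j) forces j = j₀.
module Submission where

open import Defs
open import Data.Product using (Σ; _×_; _,_; proj₁; proj₂)
open import Data.Sum using (_⊎_; inj₁; inj₂; [_,_]′)
open import Relation.Nullary using (¬_; Dec; yes; no; contradiction)
open import Relation.Binary.PropositionalEquality using (_≡_; refl; sym; subst; cong)
open import Relation.Binary.Lattice.Structures using (IsBoundedLattice)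

module _ (L : FiniteLattice) where
  open FiniteLattice L
  open IsBoundedLattice isBoundedLattice
    using (antisym; x≤x∨y; y≤x∨y; ∨-least; x∧y≤x; x∧y≤y; ∧-greatest)
    renaming (refl to ≤-refl; trans to ≤-trans)

  private variable
    a b j₀ m₀ m x y z j : Carrier
    κ κ₁ κ₂ : Carrier → Carrier

  -- The duplicated IsJI makes InM∩J ⊥ ⊤ κ x y j unfold to InML L κ x j × InJL L y j.
  InM∩J : Carrier → Carrier → (Carrier → Carrier) → Carrier → Carrier → Carrier → Set
  InM∩J a b κ x y j = (IsJI L a b j × x ≤ κ j) × (IsJI L a b j × j ≤ y)

  ⋖-bottom : Dec (x ≡ z) → _⋖_ L x y → x ≤ z → z ≤ y → ¬ z ≡ y → x ≡ z
  ⋖-bottom (yes x≡z) _             _   _   _   = x≡z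
  ⋖-bottom (no x≢z)  (_ , between) x≤z z≤y z≢y = contradiction (z≤y , z≢y) (between _ (x≤z , x≢z))

  ⋖-top : Dec (z ≡ y) → _⋖_ L x y → x ≤ z → z ≤ y → ¬ x ≡ z → z ≡ y
  ⋖-top (yes z≡y) _             _   _   _   = z≡y
  ⋖-top (no z≢y)  (_ , between) x≤z z≤y x≢z = contradiction (z≤y , z≢y) (between _ (x≤z , x≢z))

  -- The lower covers of j in [a,b] do not depend on b.
  IsJI-widen : b ≤ y → IsJI L a b j → IsJI L a y j
  IsJI-widen b≤y ((a≤j , j≤b) , lowerCover) = (a≤j , ≤-trans j≤b b≤y) , lowerCover

  pairing-onto : IsPairing L a b κ → IsMI L a b m → Σ Carrier λ j → IsJI L a b j × κ j ≡ m
  pairing-onto (_ , _ , onto , _) = onto _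

  pairing-InJset : IsPairing L a b κ → IsJI L a b j → InJset L a b (κ j) j
  pairing-InJset (_ , _ , _ , _ , inJ) = inJ _

  j≰κj : IsPairing L a b κ → IsJI L a b j → ¬ j ≤ κ j
  j≰κj {κ = κ} {j = j} (_ , _ , _ , inM , _) jJI j≤κj =
    j∧κj≢j (antisym (x∧y≤x j (κ j)) (∧-greatest ≤-refl j≤κj))
    where
    j∧κj≢j : ¬ j ∧ κ j ≡ j
    j∧κj≢j with inM j jJI
    ... | (_ , (_ , ((_ , j∧κj≢j) , _))) , _ = j∧κj≢j

  DecidableOn : Carrier → Carrier → Set
  DecidableOn a b = ∀ {z w} → InI L a b z → InI L a b w → Dec (z ≡ w)

  -- Carrier has no decidable equality, but a dismantling decides it on the interval:
  -- elements on different sides of a prime pair differ.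
  compatDism⇒decidable : CompatDism L a b κ → DecidableOn a b
  compatDism⇒decidable (single _ _ _ _ refl) (a≤z , z≤a) (a≤w , w≤a) =
    yes (antisym (≤-trans z≤a a≤w) (≤-trans w≤a a≤z))
  compatDism⇒decidable (step _ _ _ _ _ _ _ _ (_ , _ , split) upper _ lower _) {z} {w}
                       z∈@(a≤z , z≤b) w∈@(a≤w , w≤b) with split z z∈ | split w w∈
  ... | (inj₂ j₀≤z , _) | (inj₂ j₀≤w , _) = compatDism⇒decidable upper (j₀≤z , z≤b) (j₀≤w , w≤b)
  ... | (inj₁ z≤m₀ , _) | (inj₁ w≤m₀ , _) = compatDism⇒decidable lower (a≤z , z≤m₀) (a≤w , w≤m₀)
  ... | (inj₁ z≤m₀ , _) | (inj₂ j₀≤w , notBoth) = no λ { refl → notBoth (z≤m₀ , j₀≤w) }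
  ... | (inj₂ j₀≤z , notBoth) | (inj₁ w≤m₀ , _) = no λ { refl → notBoth (w≤m₀ , j₀≤z) }

  -- m ⋖ m ∨ j forces m ∨ z = m ∨ j, so z competes with j in the minimum defining J(m).
  J-minimal : DecidableOn a b → InJset L a b m j → InI L a b z → z ≤ j → ¬ z ≤ m → z ≡ j
  J-minimal {a = a} {b = b} {m = m} {j = j} {z = z} _≟_ (((a≤j , _) , m∨j≤b , m⋖m∨j) , least)
            z∈@(a≤z , _) z≤j z≰m =
    least z z∈ (≤-trans m∨z≤m∨j m∨j≤b , subst (_⋖_ L m) (sym m∨z≡m∨j) m⋖m∨j) z≤j
    where
    m∨z≤m∨j : m ∨ z ≤ m ∨ j
    m∨z≤m∨j = ∨-least (x≤x∨y m j) (≤-trans z≤j (y≤x∨y m j))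
    m∨z∈ : InI L a b (m ∨ z)
    m∨z∈ = ≤-trans a≤z (y≤x∨y m z) , ≤-trans m∨z≤m∨j m∨j≤b
    m∨j∈ : InI L a b (m ∨ j)
    m∨j∈ = ≤-trans a≤j (y≤x∨y m j) , m∨j≤b
    m∨z≡m∨j : m ∨ z ≡ m ∨ j
    m∨z≡m∨j = ⋖-top (m∨z∈ ≟ m∨j∈) m⋖m∨j (x≤x∨y m z) m∨z≤m∨j
                λ m≡m∨z → z≰m (subst (z ≤_) (sym m≡m∨z) (y≤x∨y m z))

  module PrimePair {a b j₀ m₀ κ} (P : IsPairing L a b κ) (_≟_ : DecidableOn a b)
                   (prime : IsPrimePair L a b j₀ m₀) where

    j₀∈ : InI L a b j₀
    j₀∈ = proj₁ prime

    m₀∈ : InI L a b m₀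
    m₀∈ = proj₁ (proj₂ prime)

    side : InI L a b z → z ≤ m₀ ⊎ j₀ ≤ z
    side z∈ = proj₁ (proj₂ (proj₂ prime) _ z∈)

    not-both : InI L a b z → ¬ (z ≤ m₀ × j₀ ≤ z)
    not-both z∈ = proj₂ (proj₂ (proj₂ prime) _ z∈)

    j₀≰m₀ : ¬ j₀ ≤ m₀
    j₀≰m₀ j₀≤m₀ = not-both j₀∈ (j₀≤m₀ , ≤-refl)

    m₀∨j₀∈ : InI L a b (m₀ ∨ j₀)
    m₀∨j₀∈ = ≤-trans (proj₁ m₀∈) (x≤x∨y m₀ j₀) , ∨-least (proj₂ m₀∈) (proj₂ j₀∈)

    m₀≢m₀∨j₀ : ¬ m₀ ≡ m₀ ∨ j₀
    m₀≢m₀∨j₀ m₀≡m₀∨j₀ = j₀≰m₀ (subst (j₀ ≤_) (sym m₀≡m₀∨j₀) (y≤x∨y m₀ j₀))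

    m₀⋖m₀∨j₀ : _⋖_ L m₀ (m₀ ∨ j₀)
    m₀⋖m₀∨j₀ = (x≤x∨y m₀ j₀ , m₀≢m₀∨j₀) , between
      where
      between : (z : Carrier) → _<_ L m₀ z → ¬ _<_ L z (m₀ ∨ j₀)
      between z (m₀≤z , m₀≢z) (z≤m₀∨j₀ , z≢m₀∨j₀) =
        [ (λ z≤m₀ → m₀≢z (antisym m₀≤z z≤m₀)) , (λ j₀≤z → z≢m₀∨j₀ (antisym z≤m₀∨j₀ (∨-least m₀≤z j₀≤z))) ]′
          (side (≤-trans (proj₁ m₀∈) m₀≤z , ≤-trans z≤m₀∨j₀ (proj₂ m₀∨j₀∈)))

    m₀-meetIrreducible : IsMI L a b m₀
    m₀-meetIrreducible = m₀∈ , m₀ ∨ j₀ , (proj₂ m₀∨j₀∈ , m₀⋖m₀∨j₀) , only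
      where
      only : (w : Carrier) → UpperCov L b m₀ w → w ≡ m₀ ∨ j₀
      only w (w≤b , m₀⋖w@((m₀≤w , m₀≢w) , _)) =
        [ (λ w≤m₀ → contradiction (antisym m₀≤w w≤m₀) m₀≢w)
        , (λ j₀≤w → sym (⋖-top (m₀∨j₀∈ ≟ w∈) m₀⋖w (x≤x∨y m₀ j₀) (∨-least m₀≤w j₀≤w) m₀≢m₀∨j₀)) ]′ (side w∈)
        where
        w∈ : InI L a b w
        w∈ = ≤-trans (proj₁ m₀∈) m₀≤w , w≤b

    j₀-paired : IsJI L a b j₀ × κ j₀ ≡ m₀
    j₀-paired with pairing-onto P m₀-meetIrreducible
    ... | j , jJI , refl = subst (IsJI L a b) (sym j₀≡j) jJI , cong κ j₀≡j
      where
      j₀≤j : j₀ ≤ j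
      j₀≤j = [ (λ j≤κj → contradiction j≤κj (j≰κj P jJI)) , (λ j₀≤j → j₀≤j) ]′ (side (proj₁ jJI))
      j₀≡j : j₀ ≡ j
      j₀≡j = J-minimal _≟_ (pairing-InJset P jJI) j₀∈ j₀≤j j₀≰m₀

    module Straddle (x⋖y : _⋖_ L x y) (a≤x : a ≤ x) (y≤b : y ≤ b) (x≤m₀ : x ≤ m₀) (j₀≤y : j₀ ≤ y) where

      x≤y : x ≤ y
      x≤y = proj₁ (proj₁ x⋖y)

      x∈ : InI L a b x
      x∈ = a≤x , ≤-trans x≤y y≤b

      y∈ : InI L a b y
      y∈ = ≤-trans a≤x x≤y , y≤b

      x≡y∧m₀ : x ≡ y ∧ m₀
      x≡y∧m₀ = ⋖-bottom (x∈ ≟ y∧m₀∈) x⋖y (∧-greatest x≤y x≤m₀) (x∧y≤x y m₀)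
                 λ y∧m₀≡y → not-both y∈ (subst (_≤ m₀) y∧m₀≡y (x∧y≤y y m₀) , j₀≤y)
        where
        y∧m₀∈ : InI L a b (y ∧ m₀)
        y∧m₀∈ = ∧-greatest (proj₁ y∈) (proj₁ m₀∈) , ≤-trans (x∧y≤x y m₀) y≤b

      x∨j₀≡y : x ∨ j₀ ≡ y
      x∨j₀≡y = ⋖-top (x∨j₀∈ ≟ y∈) x⋖y (x≤x∨y x j₀) (∨-least x≤y j₀≤y)
                 λ x≡x∨j₀ → not-both x∈ (x≤m₀ , subst (j₀ ≤_) (sym x≡x∨j₀) (y≤x∨y x j₀))
        where
        x∨j₀∈ : InI L a b (x ∨ j₀)
        x∨j₀∈ = ≤-trans a≤x (x≤x∨y x j₀) , ≤-trans (∨-least x≤y j₀≤y) y≤b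

      only-j₀ : InM∩J a b κ x y j → j ≡ j₀
      only-j₀ {j} ((jJI , x≤κj) , (_ , j≤y)) = sym (J-minimal _≟_ (pairing-InJset P jJI) j₀∈ j₀≤j j₀≰κj)
        where
        j₀≤j : j₀ ≤ j
        j₀≤j = [ (λ j≤m₀ → contradiction (≤-trans (∧-greatest j≤y j≤m₀) (subst (_≤ κ j) x≡y∧m₀ x≤κj))
                                         (j≰κj P jJI))
               , (λ j₀≤j → j₀≤j) ]′ (side (proj₁ jJI))
        j₀≰κj : ¬ j₀ ≤ κ j
        j₀≰κj j₀≤κj = j≰κj P jJI (≤-trans j≤y (subst (_≤ κ j) x∨j₀≡y (∨-least x≤κj j₀≤κj)))

      unique-overlap : ExactlyOne (InM∩J a b κ x y)
      unique-overlap with j₀-paired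
      ... | j₀JI , κj₀≡m₀ = j₀ , ((j₀JI , subst (x ≤_) (sym κj₀≡m₀) x≤m₀) , (j₀JI , j₀≤y)) , λ _ → only-j₀

  overlap-above : CondUpper L a b κ j₀ κ₁ → j₀ ≤ x → x ≤ y →
                  ExactlyOne (InM∩J j₀ b κ₁ x y) → ExactlyOne (InM∩J a b κ x y)
  overlap-above {a = a} {b = b} {κ = κ} {j₀ = j₀} {κ₁ = κ₁} {x = x} {y = y}
                (toJI , α-injective , α-surjective , κ₁∘α) j₀≤x x≤y
                (j' , ((j'JI , x≤κ₁j') , (_ , j'≤y)) , unique) with α-surjective j' j'JI
  ... | j , jJI , j₀≤κj , refl =
    j , ((jJI , subst (x ≤_) (κ₁∘α j jJI j₀≤κj) x≤κ₁j') , (jJI , ≤-trans (y≤x∨y j₀ j) j'≤y)) , only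
    where
    only : (j₂ : Carrier) → InM∩J a b κ x y j₂ → j₂ ≡ j
    only j₂ ((j₂JI , x≤κj₂) , (_ , j₂≤y)) =
      α-injective j₂ j j₂JI j₀≤κj₂ jJI j₀≤κj (unique (j₀ ∨ j₂) ((αj₂JI , x≤κ₁αj₂) , (αj₂JI , αj₂≤y)))
      where
      j₀≤κj₂ : j₀ ≤ κ j₂
      j₀≤κj₂ = ≤-trans j₀≤x x≤κj₂
      αj₂JI : IsJI L j₀ b (j₀ ∨ j₂)
      αj₂JI = toJI j₂ j₂JI j₀≤κj₂
      x≤κ₁αj₂ : x ≤ κ₁ (j₀ ∨ j₂)
      x≤κ₁αj₂ = subst (x ≤_) (sym (κ₁∘α j₂ j₂JI j₀≤κj₂)) x≤κj₂
      αj₂≤y : j₀ ∨ j₂ ≤ y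
      αj₂≤y = ∨-least (≤-trans j₀≤x x≤y) j₂≤y

  overlap-below : m₀ ≤ b → CondLower L a b κ m₀ κ₂ → x ≤ y → y ≤ m₀ →
                  ExactlyOne (InM∩J a m₀ κ₂ x y) → ExactlyOne (InM∩J a b κ x y)
  overlap-below {m₀ = m₀} {b = b} {a = a} {κ = κ} {x = x} {y = y} m₀≤b (_ , _ , _ , restrict) x≤y y≤m₀
                (j , ((jJI₂ , x≤κ₂j) , (_ , j≤y)) , unique)
                with restrict j (IsJI-widen m₀≤b jJI₂) (≤-trans j≤y y≤m₀)
  ... | _ , κ₂j≡m₀∧κj = j , ((jJI , x≤κj) , (jJI , j≤y)) , only
    where
    jJI : IsJI L a b j
    jJI = IsJI-widen m₀≤b jJI₂
    x≤κj : x ≤ κ j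
    x≤κj = ≤-trans (subst (x ≤_) κ₂j≡m₀∧κj x≤κ₂j) (x∧y≤y m₀ (κ j))
    only : (j₂ : Carrier) → InM∩J a b κ x y j₂ → j₂ ≡ j
    only j₂ ((j₂JI , x≤κj₂) , (_ , j₂≤y)) with restrict j₂ j₂JI (≤-trans j₂≤y y≤m₀)
    ... | j₂JI₂ , κ₂j₂≡m₀∧κj₂ =
      unique j₂ ((j₂JI₂ , subst (x ≤_) (sym κ₂j₂≡m₀∧κj₂) (∧-greatest (≤-trans x≤y y≤m₀) x≤κj₂)) , (j₂JI₂ , j₂≤y))

  compatDism⇒overlap : CompatDism L a b κ → a ≤ x → y ≤ b → _⋖_ L x y → ExactlyOne (InM∩J a b κ x y)
  compatDism⇒overlap (single _ _ _ _ refl) a≤x y≤a ((x≤y , x≢y) , _) =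
    contradiction (antisym x≤y (≤-trans y≤a a≤x)) x≢y
  compatDism⇒overlap cd@(step _ _ _ _ _ _ _ (P , _) prime@(_ , (_ , m₀≤b) , split) upper condUpper lower condLower)
                     a≤x y≤b x⋖y@((x≤y , _) , _)
    with split _ (a≤x , ≤-trans x≤y y≤b) | split _ (≤-trans a≤x x≤y , y≤b)
  ... | inj₂ j₀≤x , _ | _ =
    overlap-above condUpper j₀≤x x≤y (compatDism⇒overlap upper j₀≤x y≤b x⋖y)
  ... | inj₁ _ , _ | inj₁ y≤m₀ , _ =
    overlap-below m₀≤b condLower x≤y y≤m₀ (compatDism⇒overlap lower a≤x y≤m₀ x⋖y)
  ... | inj₁ x≤m₀ , _ | inj₂ j₀≤y , _ =
    PrimePair.Straddle.unique-overlap P (compatDism⇒decidable cd) prime x⋖y a≤x y≤b x≤m₀ j₀≤y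

proposition5p3 : (L : FiniteLattice) (κ : FiniteLattice.Carrier L → FiniteLattice.Carrier L) →
    CompatiblyDismantlable L κ → Overlapping L κ
proposition5p3 L κ cd x y x⋖y = compatDism⇒overlap L cd (minimum x) (maximum y) x⋖y
  where open IsBoundedLattice (FiniteLattice.isBoundedLattice L) using (minimum; maximum)
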